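{- Let $P$ be a finite poset, let $C=\{c_1\prec\cdots\prec c_k\}$ be a longest chain of $P$, and let $i\in\{0,\dots,k\}$. With the notation below, the map $\varphi_i^P:\mathcal{I}_i(P)\to\mathcal{I}(P_i)$, $I\mapsto I\setminus D_i$, is a well-defined bijection, and its inverse maps $I'\in\mathcal{I}(P_i)$ to $I'\cup D_i\in\mathcal{I}_i(P)$.
   Context: $P$ is a finite partially ordered set with order $\preceq$. An ideal of a poset is a downward-closed subset; $\mathcal{I}(P)$ denotes the set of ideals of $P$. Add virtual elements $c_0,c_{k+1}$ with $c_0\prec u\prec c_{k+1}$ for all $u\in P$. For an ideal $I$ let $\zeta(I)=\max\{j: c_j\in I\}$, with $\zeta(I)=0$ if $I\cap C=\emptyset$, and $\mathcal{I}_i(P)=\{I\in\mathcal{I}(P):\zeta(I)=i\}$. Let $D_i=\{u\in P: u\preceq c_i\}$ (so $D_0=\emptyset$) and let $P_i$ be the subposet of $P$ consisting of all $u\in P$ with $u\not\preceq c_i$ and $u\not\succeq c_{i+1}$. -}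

module Defs where

open import Level using (0ℓ)
open import Data.Nat using (ℕ; zero; suc; _≤_; _<?_; _⊔_)
open import Data.Fin using (Fin; toℕ; fromℕ<) renaming (_<_ to _<ᶠ_)
open import Data.Fin.Subset using (Subset; _∈_; _⊆_)
open import Data.Bool using (Bool; true; false; not; _∧_; if_then_else_)
open import Data.Vec using (tabulate; lookup)
open import Data.List using (List; foldr; map; allFin)
open import Data.Product using (_×_)
open import Relation.Binary using (Rel; Decidable)
open import Relation.Binary.PropositionalEquality using (_≡_; _≢_)
open import Relation.Nullary using (does; yes; no)

-- A finite poset is modelled on the carrier Fin n, with a (decidable)
-- partial order _≼_ w.r.t. propositional equality (IsDecPartialOrder in the statement).
module _ {n : ℕ} (_≼_ : Rel (Fin n) 0ℓ) where

  _≺_ : Rel (Fin n) 0ℓ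
  x ≺ y = (x ≼ y) × (x ≢ y)

  -- a chain c₁ ≺ c₂ ≺ ⋯ ≺ c_m, given as a strictly increasing sequence
  -- (0-based index j stands for c_{j+1})
  IsChain : {m : ℕ} → (Fin m → Fin n) → Set
  IsChain c = ∀ a b → a <ᶠ b → c a ≺ c b

  IsLongestChain : {k : ℕ} → (Fin k → Fin n) → Set
  IsLongestChain {k} c = IsChain c × (∀ m (d : Fin m → Fin n) → IsChain d → m ≤ k)

  IsIdeal : Subset n → Set
  IsIdeal I = ∀ u v → v ≼ u → u ∈ I → v ∈ I

  IsIdealOf : Subset n → Subset n → Set
  IsIdealOf Q I = (I ⊆ Q) × (∀ u v → u ∈ Q → v ∈ Q → v ≼ u → u ∈ I → v ∈ I)

  module _ (_≼?_ : Decidable _≼_) {k : ℕ} (c : Fin k → Fin n) where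

    -- ζ(I) = max{ j : c_j ∈ I }, and 0 if I ∩ C = ∅
    -- (c_0 is virtual and below everything; c_{k+1} is never in an ideal of P)
    ζ : Subset n → ℕ
    ζ I = foldr _⊔_ 0 (map (λ j → if lookup I (c j) then suc (toℕ j) else 0) (allFin k))

    -- u ≼ c_i  (false for i = 0, since c_0 ≺ u for every u ∈ P)
    belowᵇ : Fin (suc k) → Fin n → Bool
    belowᵇ Fin.zero    u = false
    belowᵇ (Fin.suc j) u = does (u ≼? c j)

    -- u ≽ c_{i+1}  (false for i = k, since u ≺ c_{k+1} for every u ∈ P)
    aboveNextᵇ : Fin (suc k) → Fin n → Bool
    aboveNextᵇ i u with toℕ i <? k
    ... | yes p = does (c (fromℕ< p) ≼? u)
    ... | no _  = false

    D : Fin (suc k) → Subset n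
    D i = tabulate (belowᵇ i)

    Pᵢ : Fin (suc k) → Subset n
    Pᵢ i = tabulate (λ u → not (belowᵇ i u) ∧ not (aboveNextᵇ i u))

{-# OPTIONS --safe #-}
-- An ideal I with ζ(I) = i contains c_i, hence all of D_i, and misses c_{i+1},
-- hence everything above it; so I ∖ D_i lies in P_i and I = (I ∖ D_i) ∪ D_i.
-- Conversely, for an ideal I′ of P_i, an element below some u ∈ I′ is either in D_i
-- or again in P_i (being above c_{i+1} would put u above it), so I′ ∪ D_i is an ideal;
-- it contains c_i and no c_j with j > i, as such a c_j is not below c_i and lies above
-- c_{i+1}.
module Submission where

open import Defs
open import Level using (0ℓ)
open import Data.Bool using (Bool; true; false; not; _∧_; T; if_then_else_)
open import Data.Bool.Properties using (T-≡)
open import Data.Fin using (Fin; zero; suc; toℕ; fromℕ<)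
open import Data.Fin.Properties using (toℕ-injective; toℕ-fromℕ<; toℕ<n)
open import Data.Fin.Subset using (Subset; inside; outside; _∈_; _∉_; _⊆_; _∪_; _∩_; _─_; Empty)
open import Data.Fin.Subset.Properties using (_∈?_; q⊆p∪q; x∈p∩q⁻; drop-∷-Empty; drop-∷-⊆; x∈p∪q⁺; x∈p∪q⁻; p─q⊆p; x∈p∧x∉q⇒x∈p─q)
open import Data.List using (List; foldr; map; allFin)
import Data.List.Membership.Propositional as List
open import Data.List.Membership.Propositional.Properties using (∈-map⁺; ∈-map⁻; ∈-allFin; foldr-selective)
open import Data.List.Properties using (foldr-preservesᵇ; foldr-preservesᵒ)
import Data.List.Relation.Unary.All as All
import Data.List.Relation.Unary.Any as Any
open import Data.Nat using (ℕ; suc; _≤_; _<_; _<?_; _⊔_; z≤n; s≤s)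
import Data.Nat.Properties as ℕ
open import Data.Product using (_×_; _,_; proj₁; proj₂; ∃-syntax)
open import Data.Sum using (_⊎_; inj₁; inj₂; [_,_]′)
open import Data.Vec using (tabulate; lookup; _∷_; []; here; there)
open import Data.Vec.Properties using (lookup∘tabulate; []=⇒lookup; lookup⇒[]=)
open import Function using (_∘_; case_of_)
open import Function.Bundles using (Equivalence)
open import Relation.Binary using (Rel; IsPartialOrder; IsDecPartialOrder)
open import Relation.Binary.PropositionalEquality using (_≡_; refl; sym; trans; cong; subst; subst₂)
open import Relation.Nullary using (¬_; Dec; yes; no; does; contradiction)

foldr-⊔-upper : ∀ {x} {xs : List ℕ} → x List.∈ xs → x ≤ foldr _⊔_ 0 xs
foldr-⊔-upper x∈xs = foldr-preservesᵒ ⊔-upper 0 _ (inj₂ (Any.map ℕ.≤-reflexive x∈xs))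
  where
  ⊔-upper : ∀ {x} m n → x ≤ m ⊎ x ≤ n → x ≤ m ⊔ n
  ⊔-upper m n = [ ℕ.m≤n⇒m≤n⊔o n , ℕ.m≤n⇒m≤o⊔n m ]′

foldr-⊔-least : ∀ {m} (xs : List ℕ) → (∀ {x} → x List.∈ xs → x ≤ m) → foldr _⊔_ 0 xs ≤ m
foldr-⊔-least xs bound = foldr-preservesᵇ ℕ.⊔-lub z≤n (All.tabulate bound)

foldr-⊔-suc-∈ : ∀ {m} (xs : List ℕ) → foldr _⊔_ 0 xs ≡ suc m → suc m List.∈ xs
foldr-⊔-suc-∈ xs eq with foldr-selective ℕ.⊔-sel 0 xs
... | inj₁ ≡0 = contradiction (trans (sym eq) ≡0) λ ()
... | inj₂ ∈xs = subst (List._∈ xs) eq ∈xs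

T-does⁻ : ∀ {A : Set} (a? : Dec A) → T (does a?) → A
T-does⁻ (yes a) _ = a

T-does⁺ : ∀ {A : Set} (a? : Dec A) → A → T (does a?)
T-does⁺ (yes _) _ = _
T-does⁺ (no ¬a) a = ¬a a

T-not∧not⁻ : ∀ {a b} → T (not a ∧ not b) → ¬ T a × ¬ T b
T-not∧not⁻ {false} {false} _ = (λ ()) , (λ ())

T-not∧not⁺ : ∀ {a b} → ¬ T a → ¬ T b → T (not a ∧ not b)
T-not∧not⁺ {true}          ¬a _  = ¬a _
T-not∧not⁺ {false} {true}  _  ¬b = ¬b _
T-not∧not⁺ {false} {false} _  _  = _

x∈tabulate⁻ : ∀ {n} {f : Fin n → Bool} {x} → x ∈ tabulate f → T (f x)
x∈tabulate⁻ {f = f} {x} x∈ = Equivalence.from T-≡ (trans (sym (lookup∘tabulate f x)) ([]=⇒lookup x∈))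

x∈tabulate⁺ : ∀ {n} {f : Fin n → Bool} {x} → T (f x) → x ∈ tabulate f
x∈tabulate⁺ {f = f} {x} fx = lookup⇒[]= x _ (trans (lookup∘tabulate f x) (Equivalence.to T-≡ fx))

x∈p─q⇒x∉q : ∀ {n} (p q : Subset n) {x} → x ∈ p ─ q → x ∉ q
x∈p─q⇒x∉q (_ ∷ p) (outside ∷ q) here       ()
x∈p─q⇒x∉q (_ ∷ p) (_ ∷ q)       (there x∈) (there x∈q) = x∈p─q⇒x∉q p q x∈ x∈q

p⊆q⇒[q─p]∪p≡q : ∀ {n} {p q : Subset n} → p ⊆ q → (q ─ p) ∪ p ≡ q
p⊆q⇒[q─p]∪p≡q {p = []}          {[]}          _   = refl
p⊆q⇒[q─p]∪p≡q {p = inside ∷ p}  {inside ∷ q}  p⊆q = cong (inside ∷_) (p⊆q⇒[q─p]∪p≡q (drop-∷-⊆ p⊆q))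
p⊆q⇒[q─p]∪p≡q {p = inside ∷ p}  {outside ∷ q} p⊆q with () ← p⊆q here
p⊆q⇒[q─p]∪p≡q {p = outside ∷ p} {inside ∷ q}  p⊆q = cong (inside ∷_) (p⊆q⇒[q─p]∪p≡q (drop-∷-⊆ p⊆q))
p⊆q⇒[q─p]∪p≡q {p = outside ∷ p} {outside ∷ q} p⊆q = cong (outside ∷_) (p⊆q⇒[q─p]∪p≡q (drop-∷-⊆ p⊆q))

Empty[p∩q]⇒p∪q─q≡p : ∀ {n} {p q : Subset n} → Empty (p ∩ q) → p ∪ q ─ q ≡ p
Empty[p∩q]⇒p∪q─q≡p {p = []}          {[]}          _     = refl
Empty[p∩q]⇒p∪q─q≡p {p = inside ∷ p}  {inside ∷ q}  empty = contradiction (zero , here) empty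
Empty[p∩q]⇒p∪q─q≡p {p = inside ∷ p}  {outside ∷ q} empty = cong (inside ∷_) (Empty[p∩q]⇒p∪q─q≡p (drop-∷-Empty empty))
Empty[p∩q]⇒p∪q─q≡p {p = outside ∷ p} {inside ∷ q}  empty = cong (outside ∷_) (Empty[p∩q]⇒p∪q─q≡p (drop-∷-Empty empty))
Empty[p∩q]⇒p∪q─q≡p {p = outside ∷ p} {outside ∷ q} empty = cong (outside ∷_) (Empty[p∩q]⇒p∪q─q≡p (drop-∷-Empty empty))

module _ {n} {_≼_ : Rel (Fin n) 0ℓ} (po : IsPartialOrder _≡_ _≼_)
         {k} {c : Fin k → Fin n} (chain : IsChain _≼_ c) where
  open IsPartialOrder po using (antisym) renaming (refl to ≼-refl)

  chain-monotone : ∀ {a b} → toℕ a ≤ toℕ b → c a ≼ c b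
  chain-monotone a≤b with ℕ.m≤n⇒m<n∨m≡n a≤b
  ... | inj₁ a<b = proj₁ (chain _ _ a<b)
  ... | inj₂ a≡b rewrite toℕ-injective a≡b = ≼-refl

  chain-reflects : ∀ {a b} → c a ≼ c b → toℕ a ≤ toℕ b
  chain-reflects ca≼cb = ℕ.≮⇒≥ λ b<a → proj₂ (chain _ _ b<a) (antisym (proj₁ (chain _ _ b<a)) ca≼cb)

module _ {n} (_≼_ : Rel (Fin n) 0ℓ) (po : IsDecPartialOrder _≡_ _≼_)
         {k} {c : Fin k → Fin n} (chain : IsChain _≼_ c) where
  open IsDecPartialOrder po using (isPartialOrder; _≤?_) renaming (refl to ≼-refl; trans to ≼-trans)

  ζ′ : Subset n → ℕ
  ζ′ = ζ _≼_ _≤?_ c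

  D′ P′ : Fin (suc k) → Subset n
  D′ = D _≼_ _≤?_ c
  P′ = Pᵢ _≼_ _≤?_ c

  rank : Subset n → Fin k → ℕ
  rank I j = if lookup I (c j) then suc (toℕ j) else 0

  c∈⇒<ζ : ∀ {I j} → c j ∈ I → toℕ j < ζ′ I
  c∈⇒<ζ {I} {j} cj∈I = subst (_≤ ζ′ I) rank≡ (foldr-⊔-upper (∈-map⁺ (rank I) (∈-allFin j)))
    where
    rank≡ : rank I j ≡ suc (toℕ j)
    rank≡ rewrite []=⇒lookup cj∈I = refl

  ζ-least : ∀ {I m} → (∀ j → c j ∈ I → toℕ j < m) → ζ′ I ≤ m
  ζ-least {I} {m} bound = foldr-⊔-least (map (rank I) (allFin k)) λ x∈ →
    case ∈-map⁻ (rank I) x∈ of λ { (j , _ , refl) → rank≤ j }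
    where
    rank≤ : ∀ j → rank I j ≤ m
    rank≤ j with lookup I (c j) in cj
    ... | true  = bound j (lookup⇒[]= (c j) I cj)
    ... | false = z≤n

  ζ-attained : ∀ {I m} → ζ′ I ≡ suc m → ∃[ j ] c j ∈ I × toℕ j ≡ m
  ζ-attained {I} eq with ∈-map⁻ (rank I) (foldr-⊔-suc-∈ (map (rank I) (allFin k)) eq)
  ... | j , _ , m+1≡rank with lookup I (c j) in cj
  ...   | true = j , lookup⇒[]= (c j) I cj , ℕ.suc-injective (sym m+1≡rank)

  ∉D-zero : ∀ {u} → u ∉ D′ zero
  ∉D-zero = x∈tabulate⁻ {f = belowᵇ _≼_ _≤?_ c zero}

  ∈D⁻ : ∀ {j u} → u ∈ D′ (suc j) → u ≼ c j
  ∈D⁻ {j} {u} = T-does⁻ (u ≤? c j) ∘ x∈tabulate⁻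

  ∈D⁺ : ∀ {j u} → u ≼ c j → u ∈ D′ (suc j)
  ∈D⁺ {j} {u} = x∈tabulate⁺ ∘ T-does⁺ (u ≤? c j)

  D-isIdeal : ∀ i → IsIdeal _≼_ (D′ i)
  D-isIdeal zero    u v _   u∈D = contradiction u∈D ∉D-zero
  D-isIdeal (suc j) u v v≼u u∈D = ∈D⁺ (≼-trans v≼u (∈D⁻ u∈D))

  -- c_{i+1} ≼ u, where c_{i+1} is the chain element of 0-based index i
  AboveNext : Fin (suc k) → Fin n → Set
  AboveNext i u = ∃[ j ] toℕ j ≡ toℕ i × c j ≼ u

  aboveNextᵇ⁻ : ∀ {i u} → T (aboveNextᵇ _≼_ _≤?_ c i u) → AboveNext i u
  aboveNextᵇ⁻ {i} {u} t with toℕ i <? k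
  ... | yes i<k = fromℕ< i<k , toℕ-fromℕ< i<k , T-does⁻ (c (fromℕ< i<k) ≤? u) t

  aboveNextᵇ⁺ : ∀ {i u} → AboveNext i u → T (aboveNextᵇ _≼_ _≤?_ c i u)
  aboveNextᵇ⁺ {i} {u} (j , j≡i , cj≼u) with toℕ i <? k
  ... | yes i<k = T-does⁺ (c (fromℕ< i<k) ≤? u) (subst (λ j → c j ≼ u) j≡i<k cj≼u)
    where
    j≡i<k : j ≡ fromℕ< i<k
    j≡i<k = toℕ-injective (trans j≡i (sym (toℕ-fromℕ< i<k)))
  ... | no i≮k = i≮k (subst (_< k) j≡i (toℕ<n j))

  AboveNext-upward : ∀ {i u v} → v ≼ u → AboveNext i v → AboveNext i u
  AboveNext-upward v≼u (j , j≡i , cj≼v) = j , j≡i , ≼-trans cj≼v v≼u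

  ≤⇒AboveNext-c : ∀ {i j} → toℕ i ≤ toℕ j → AboveNext i (c j)
  ≤⇒AboveNext-c {i} {j} i≤j = fromℕ< i<k , toℕ-fromℕ< i<k , chain-monotone isPartialOrder chain i≤′j
    where
    i<k : toℕ i < k
    i<k = ℕ.≤-<-trans i≤j (toℕ<n j)
    i≤′j : toℕ (fromℕ< i<k) ≤ toℕ j
    i≤′j = subst (_≤ toℕ j) (sym (toℕ-fromℕ< i<k)) i≤j

  ∈P⁻ : ∀ {i u} → u ∈ P′ i → u ∉ D′ i × ¬ AboveNext i u
  ∈P⁻ u∈P with T-not∧not⁻ (x∈tabulate⁻ u∈P)
  ... | ¬below , ¬above = ¬below ∘ x∈tabulate⁻ , ¬above ∘ aboveNextᵇ⁺

  ∈P⁺ : ∀ {i u} → u ∉ D′ i → ¬ AboveNext i u → u ∈ P′ i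
  ∈P⁺ u∉D ¬above = x∈tabulate⁺ (T-not∧not⁺ (u∉D ∘ x∈tabulate⁺) (¬above ∘ aboveNextᵇ⁻))

  ζ≡i⇒¬AboveNext : ∀ {I i u} → IsIdeal _≼_ I → ζ′ I ≡ toℕ i → u ∈ I → ¬ AboveNext i u
  ζ≡i⇒¬AboveNext {I} {i} {u} ideal ζ≡i u∈I (j , j≡i , cj≼u) = ℕ.<-irrefl refl i<i
    where
    i<i : toℕ i < toℕ i
    i<i = subst₂ _<_ j≡i ζ≡i (c∈⇒<ζ (ideal u (c j) cj≼u u∈I))

  ζ≡i⇒D⊆I : ∀ {I i} → IsIdeal _≼_ I → ζ′ I ≡ toℕ i → D′ i ⊆ I
  ζ≡i⇒D⊆I {i = zero}  _     _   u∈D = contradiction u∈D ∉D-zero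
  ζ≡i⇒D⊆I {i = suc j} ideal ζ≡i {u} u∈D with ζ-attained ζ≡i
  ... | j′ , cj′∈I , j′≡j with refl ← toℕ-injective j′≡j = ideal (c j) u (∈D⁻ u∈D) cj′∈I

  D⊆J⇒i≤ζ : ∀ {J i} → D′ i ⊆ J → toℕ i ≤ ζ′ J
  D⊆J⇒i≤ζ {i = zero}  _   = z≤n
  D⊆J⇒i≤ζ {i = suc j} D⊆J = c∈⇒<ζ (D⊆J (∈D⁺ ≼-refl))

  c∈D⇒< : ∀ {i j} → c j ∈ D′ i → toℕ j < toℕ i
  c∈D⇒< {zero}  cj∈D = contradiction cj∈D ∉D-zero
  c∈D⇒< {suc _} cj∈D = s≤s (chain-reflects isPartialOrder chain (∈D⁻ cj∈D))

  [I─D]-isIdealOfP : ∀ {I i} → IsIdeal _≼_ I → ζ′ I ≡ toℕ i → IsIdealOf _≼_ (P′ i) (I ─ D′ i)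
  [I─D]-isIdealOfP {I} {i} ideal ζ≡i = ⊆P , downward
    where
    ⊆P : I ─ D′ i ⊆ P′ i
    ⊆P u∈ = ∈P⁺ (x∈p─q⇒x∉q I (D′ i) u∈) (ζ≡i⇒¬AboveNext ideal ζ≡i (p─q⊆p I (D′ i) u∈))
    downward : ∀ u v → u ∈ P′ i → v ∈ P′ i → v ≼ u → u ∈ I ─ D′ i → v ∈ I ─ D′ i
    downward u v _ v∈P v≼u u∈ = x∈p∧x∉q⇒x∈p─q (ideal u v v≼u (p─q⊆p I (D′ i) u∈)) (proj₁ (∈P⁻ v∈P))

  [I′∪D]-isIdeal : ∀ {I′ i} → IsIdealOf _≼_ (P′ i) I′ → IsIdeal _≼_ (I′ ∪ D′ i)
  [I′∪D]-isIdeal {I′} {i} (⊆P , downward) u v v≼u u∈ with x∈p∪q⁻ I′ (D′ i) u∈ | v ∈? D′ i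
  ... | inj₂ u∈D  | _       = x∈p∪q⁺ (inj₂ (D-isIdeal i u v v≼u u∈D))
  ... | inj₁ _    | yes v∈D = x∈p∪q⁺ (inj₂ v∈D)
  ... | inj₁ u∈I′ | no v∉D  = x∈p∪q⁺ (inj₁ (downward u v u∈P v∈P v≼u u∈I′))
    where
    u∈P : u ∈ P′ i
    u∈P = ⊆P u∈I′
    v∈P : v ∈ P′ i
    v∈P = ∈P⁺ v∉D (proj₂ (∈P⁻ u∈P) ∘ AboveNext-upward v≼u)

  ζ[I′∪D]≡i : ∀ {I′ i} → IsIdealOf _≼_ (P′ i) I′ → ζ′ (I′ ∪ D′ i) ≡ toℕ i
  ζ[I′∪D]≡i {I′} {i} (⊆P , _) = ℕ.≤-antisym (ζ-least below-i) (D⊆J⇒i≤ζ (q⊆p∪q I′ (D′ i)))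
    where
    below-i : ∀ j → c j ∈ I′ ∪ D′ i → toℕ j < toℕ i
    below-i j cj∈ with x∈p∪q⁻ I′ (D′ i) cj∈
    ... | inj₁ cj∈I′ = ℕ.≰⇒> (proj₂ (∈P⁻ (⊆P cj∈I′)) ∘ ≤⇒AboveNext-c)
    ... | inj₂ cj∈D  = c∈D⇒< cj∈D

  Empty[I′∩D] : ∀ {I′ i} → IsIdealOf _≼_ (P′ i) I′ → Empty (I′ ∩ D′ i)
  Empty[I′∩D] {I′} {i} (⊆P , _) (u , u∈) with x∈p∩q⁻ I′ (D′ i) u∈
  ... | u∈I′ , u∈D = proj₁ (∈P⁻ (⊆P u∈I′)) u∈D

lemma3p3 : {n : ℕ} (_≼_ : Rel (Fin n) 0ℓ) (po : IsDecPartialOrder _≡_ _≼_)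
           {k : ℕ} (c : Fin k → Fin n) → IsLongestChain _≼_ c → (i : Fin (suc k)) →
           ((I : Subset n) → IsIdeal _≼_ I → ζ _≼_ (IsDecPartialOrder._≤?_ po) c I ≡ toℕ i →
             IsIdealOf _≼_ (Pᵢ _≼_ (IsDecPartialOrder._≤?_ po) c i) (I ─ D _≼_ (IsDecPartialOrder._≤?_ po) c i))
           × ((I′ : Subset n) → IsIdealOf _≼_ (Pᵢ _≼_ (IsDecPartialOrder._≤?_ po) c i) I′ →
             IsIdeal _≼_ (I′ ∪ D _≼_ (IsDecPartialOrder._≤?_ po) c i)
             × ζ _≼_ (IsDecPartialOrder._≤?_ po) c (I′ ∪ D _≼_ (IsDecPartialOrder._≤?_ po) c i) ≡ toℕ i)
           × ((I : Subset n) → IsIdeal _≼_ I → ζ _≼_ (IsDecPartialOrder._≤?_ po) c I ≡ toℕ i →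
             (I ─ D _≼_ (IsDecPartialOrder._≤?_ po) c i) ∪ D _≼_ (IsDecPartialOrder._≤?_ po) c i ≡ I)
           × ((I′ : Subset n) → IsIdealOf _≼_ (Pᵢ _≼_ (IsDecPartialOrder._≤?_ po) c i) I′ →
             (I′ ∪ D _≼_ (IsDecPartialOrder._≤?_ po) c i) ─ D _≼_ (IsDecPartialOrder._≤?_ po) c i ≡ I′)
lemma3p3 _≼_ po c (chain , _) i =
    (λ I ideal ζ≡i → [I─D]-isIdealOfP _≼_ po chain ideal ζ≡i)
  , (λ I′ ideal′ → [I′∪D]-isIdeal _≼_ po chain ideal′ , ζ[I′∪D]≡i _≼_ po chain ideal′)
  , (λ I ideal ζ≡i → p⊆q⇒[q─p]∪p≡q (ζ≡i⇒D⊆I _≼_ po chain ideal ζ≡i))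
  , (λ I′ ideal′ → Empty[p∩q]⇒p∪q─q≡p (Empty[I′∩D] _≼_ po chain ideal′))
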